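{- Assume the setting described in the context. Suppose that for every object $X$ and all morphisms $\phi:\overline{F}^{*}X\multimap\overline{F}^{*}X$ and $\psi:\overline{F_\tau}X\multimap\overline{F_\tau}X$ in $\mathcal{K}l(T)$, if $\psi\cdot h_X=h_X\cdot\phi$ then $\psi^{*}\cdot h_X=h_X\cdot\phi^{*}$. Let $\alpha:X\multimap\overline{F_\tau}X$. Then every bisimulation on the $TF^*$-coalgebra $\underline{\alpha}^{\divideontimes}:X\to TF^*X$ is a bisimulation on the $TF_\tau$-coalgebra $\alpha^{\bigstar}:X\to TF_\tau X$.
   Context: Let $\mathsf{C}$ be a category with binary coproducts and $(T,\mu,\eta)$ a monad on $\mathsf{C}$. In the Kleisli category $\mathcal{K}l(T)$ (objects of $\mathsf{C}$; morphisms $X\multimap Y$ are $\mathsf{C}$-morphisms $X\to TY$; composition $g\cdot f=\mu_Z\circ Tg\circ f$; identity $1_X=\eta_X$) write $f^\sharp=\eta_Y\circ f$ for $f:X\to Y$ in $\mathsf{C}$; coproducts of $\mathcal{K}l(T)$ are those of $\mathsf{C}$, with coprojections $\iota^1,\iota^2$ and cotupling $[-,-]$. $\mathcal{K}l(T)$ is order-enriched (hom-sets are posets, composition monotone) and $T$ is an order saturation monad: for every $\alpha:X\multimap X$ there is $\alpha^{*}:X\multimap X$ with (a) $1\le\alpha^*$, (b) $\alpha\le\alpha^*$, (c) $\alpha^*\cdot\alpha^*\le\alpha^*$, (d) if $\beta:X\multimap X$ satisfies $1\le\beta$, $\alpha\le\beta$, $\beta\cdot\beta\le\beta$ then $\alpha^*\le\beta$,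 (e) for all $f:X\to Y$ in $\mathsf{C}$, $\beta:Y\multimap Y$ and $\Box\in\{\le,\ge\}$: $f^\sharp\cdot\alpha\mathrel{\Box}\beta\cdot f^\sharp$ implies $f^\sharp\cdot\alpha^*\mathrel{\Box}\beta^*\cdot f^\sharp$. A functor $S$ on $\mathsf{C}$ lifts to $\overline{S}$ on $\mathcal{K}l(T)$ if $\overline{S}X=SX$ and $\overline{S}(f^\sharp)=(Sf)^\sharp$; if $(\overline{S},m,e)$ is a monad on $\mathcal{K}l(T)$ then $TS$ is a monad on $\mathsf{C}$ whose Kleisli category is $\mathcal{K}l(\overline{S})$, with hom-sets $Hom_{\mathcal{K}l(T)}(X,\overline{S}Y)$ ordered as in $\mathcal{K}l(T)$. Standing assumptions: $\mathcal{K}l(T)$ has zero morphisms $0_{X,Y}$ (with $f\cdot 0=0=0\cdot g$). $F:\mathsf{C}\to\mathsf{C}$ lifts to $\overline{F}$, so $F_\tau=F+\mathcal{I}d$ lifts to $\overline{F_\tau}=\overline{F}+\mathcal{I}d$, which is a monad $(\overline{F_\tau},m',e')$ on $\mathcal{K}l(T)$ with $e'_X=\iota^2:X\multimap\overline{F}X+X$ and $m'_X=[\iota^1,id]\cdot(\overline{F}([0,id])+id):\overline{F}(\overline{F}X+X)+(\overline{F}X+X)\multimap\overline{F}X+X$. $F$ admits all free $F$-algebras, giving the free monad $F^*$ on $\mathsf{C}$; it lifts to $\overline{F}^*$ on $\mathcal{K}l(T)$ and $(\overline{F}^*,m,e)$ is the free monad over $\overline{F}$ in $\mathcal{K}l(T)$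 with universal natural transformation $\nu:\overline{F}\Rightarrow\overline{F}^*$. For both $(\overline{S},m,e)=(\overline{F_\tau},m',e')$ and $(\overline{S},m,e)=(\overline{F}^*,m,e)$, $\overline{S}$ is locally monotonic and $m_X\cdot\overline{S}[(m_X\cdot\overline{S}\alpha)^*\cdot e_X]=(m_X\cdot\overline{S}\alpha)^*$ for all $\alpha:X\multimap\overline{S}X$. For $\alpha:X\multimap\overline{F_\tau}X$ put $\alpha^{\bigstar}=(m'_X\cdot\overline{F_\tau}\alpha)^*\cdot e'_X$, and for $\beta:Y\multimap\overline{F}^*Y$ put $\beta^{\divideontimes}=(m_Y\cdot\overline{F}^*\beta)^*\cdot e_Y$ (these are saturation operators making $TF_\tau$ and $TF^*$ order saturation monads). $h:\overline{F}^*\Rightarrow\overline{F_\tau}$ is the unique monad morphism on $\mathcal{K}l(T)$ with $h\cdot\nu=\iota^1$ (it also satisfies $h\cdot e=e'$). For $\alpha:X\multimap\overline{F_\tau}X$ let $\underline{\alpha}=[\nu_X,e_X]\cdot\alpha:X\multimap\overline{F}^*X$. Bisimulation (kernel bisimulation): for an endofunctor $G$ on $\mathsf{C}$ and $G$-coalgebras $\alpha:X\to GX$, $\beta:Y\to GY$, a jointly monic span $X\xleftarrow{\pi_1}R\xrightarrow{\pi_2}Y$ is a bisimulation if there exist a $G$-coalgebra $\gamma:Z\to GZ$ and coalgebra homomorphisms $f$ from $\alpha$ to $\gamma$ and $g$ from $\beta$ to $\gamma$ (i.e. $Gf\circ\alpha=\gamma\circ f$, $Gg\circ\beta=\gamma\circ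 g$) such that $(R,\pi_1,\pi_2)$ is the pullback of $X\xrightarrow{f}Z\xleftarrow{g}Y$. A bisimulation on a coalgebra $\alpha$ is a bisimulation between $\alpha$ and itself. -}

module Defs where

open import Level using (Level; _⊔_) renaming (suc to lsuc)
open import Relation.Binary.PropositionalEquality using (_≡_)
open import Relation.Binary.Structures using (IsPartialOrder)
open import Data.Product using (Σ; _×_; _,_)

record RawCategory (o ℓ : Level) : Set (lsuc (o ⊔ ℓ)) where
  infixr 9 _∘_
  field
    Obj : Set o
    Hom : Obj → Obj → Set ℓ
    id  : ∀ {A} → Hom A A
    _∘_ : ∀ {A B D} → Hom B D → Hom A B → Hom A D

record IsCategory {o ℓ} (C : RawCategory o ℓ) : Set (o ⊔ ℓ) where
  open RawCategory C
  field
    identityˡ : ∀ {A B} {f : Hom A B} → id ∘ f ≡ f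
    identityʳ : ∀ {A B} {f : Hom A B} → f ∘ id ≡ f
    assoc     : ∀ {A B D E} {f : Hom A B} {g : Hom B D} {h : Hom D E} →
                (h ∘ g) ∘ f ≡ h ∘ (g ∘ f)

module _ {o ℓ} (C : RawCategory o ℓ) where
  open RawCategory C

  record Endo : Set (o ⊔ ℓ) where
    field
      F₀ : Obj → Obj
      F₁ : ∀ {A B} → Hom A B → Hom (F₀ A) (F₀ B)

  record IsEndofunctor (F : Endo) : Set (o ⊔ ℓ) where
    open Endo F
    field
      F-id : ∀ {A} → F₁ (id {A}) ≡ id
      F-∘  : ∀ {A B D} {f : Hom A B} {g : Hom B D} → F₁ (g ∘ f) ≡ F₁ g ∘ F₁ f

  IdE : Endo
  IdE = record { F₀ = λ X → X ; F₁ = λ f → f }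

  compE : Endo → Endo → Endo
  compE G F = record { F₀ = λ X → Endo.F₀ G (Endo.F₀ F X)
                     ; F₁ = λ f → Endo.F₁ G (Endo.F₁ F f) }

  Transformation : Endo → Endo → Set (o ⊔ ℓ)
  Transformation F G = ∀ X → Hom (Endo.F₀ F X) (Endo.F₀ G X)

  IsNatural : (F G : Endo) → Transformation F G → Set (o ⊔ ℓ)
  IsNatural F G σ = ∀ {A B} (f : Hom A B) → σ B ∘ Endo.F₁ F f ≡ Endo.F₁ G f ∘ σ A

  record IsMonad (S : Endo) (η : Transformation IdE S)
                 (μ : Transformation (compE S S) S) : Set (o ⊔ ℓ) where
    open Endo S
    field
      isEndofunctor : IsEndofunctor S
      η-natural     : IsNatural IdE S η
      μ-natural     : IsNatural (compE S S) S μ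
      identityˡ     : ∀ {X} → μ X ∘ F₁ (η X) ≡ id
      identityʳ     : ∀ {X} → μ X ∘ η (F₀ X) ≡ id
      assoc         : ∀ {X} → μ X ∘ F₁ (μ X) ≡ μ X ∘ μ (F₀ X)

  record IsMonadMorphism (S : Endo) (ηS : Transformation IdE S)
                         (μS : Transformation (compE S S) S)
                         (R : Endo) (ηR : Transformation IdE R)
                         (μR : Transformation (compE R R) R)
                         (k : Transformation S R) : Set (o ⊔ ℓ) where
    field
      natural : IsNatural S R k
      unit    : ∀ {X} → k X ∘ ηS X ≡ ηR X
      mult    : ∀ {X} → k X ∘ μS X ≡ μR X ∘ (Endo.F₁ R (k X) ∘ k (Endo.F₀ S X))

  record IsFreeMonadOver (F S : Endo) (η : Transformation IdE S)
                         (μ : Transformation (compE S S) S)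
                         (ν : Transformation F S) : Set (o ⊔ ℓ) where
    field
      isMonad   : IsMonad S η μ
      ν-natural : IsNatural F S ν
      universal : ∀ (R : Endo) (ηR : Transformation IdE R)
                    (μR : Transformation (compE R R) R) → IsMonad R ηR μR →
                  (σ : Transformation F R) → IsNatural F R σ →
                  Σ (Transformation S R) λ k →
                    IsMonadMorphism S η μ R ηR μR k × (∀ X → k X ∘ ν X ≡ σ X)
      unique    : ∀ (R : Endo) (ηR : Transformation IdE R)
                    (μR : Transformation (compE R R) R) → IsMonad R ηR μR →
                  (σ : Transformation F R) → IsNatural F R σ →
                  (k k′ : Transformation S R) →
                  IsMonadMorphism S η μ R ηR μR k → (∀ X → k X ∘ ν X ≡ σ X) →
                  IsMonadMorphism S η μ R ηR μR k′ → (∀ X → k′ X ∘ ν X ≡ σ X) →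
                  ∀ X → k X ≡ k′ X

  record BinaryCoproducts : Set (o ⊔ ℓ) where
    infixr 6 _+_
    field
      _+_     : Obj → Obj → Obj
      i₁      : ∀ {A B} → Hom A (A + B)
      i₂      : ∀ {A B} → Hom B (A + B)
      [_,_]   : ∀ {A B D} → Hom A D → Hom B D → Hom (A + B) D
      inject₁ : ∀ {A B D} {f : Hom A D} {g : Hom B D} → [ f , g ] ∘ i₁ ≡ f
      inject₂ : ∀ {A B D} {f : Hom A D} {g : Hom B D} → [ f , g ] ∘ i₂ ≡ g
      unique  : ∀ {A B D} {f : Hom A D} {g : Hom B D} {h : Hom (A + B) D} →
                h ∘ i₁ ≡ f → h ∘ i₂ ≡ g → h ≡ [ f , g ]

  JointlyMonic : ∀ {R X Y} → Hom R X → Hom R Y → Set (o ⊔ ℓ)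
  JointlyMonic {R} π₁ π₂ = ∀ {W} (a b : Hom W R) →
    π₁ ∘ a ≡ π₁ ∘ b → π₂ ∘ a ≡ π₂ ∘ b → a ≡ b

  IsPullback : ∀ {X Y Z R} → Hom X Z → Hom Y Z → Hom R X → Hom R Y → Set (o ⊔ ℓ)
  IsPullback {X} {Y} {Z} {R} f g π₁ π₂ =
    (f ∘ π₁ ≡ g ∘ π₂) ×
    (∀ {W} (q₁ : Hom W X) (q₂ : Hom W Y) → f ∘ q₁ ≡ g ∘ q₂ →
       Σ (Hom W R) λ u → (π₁ ∘ u ≡ q₁) × (π₂ ∘ u ≡ q₂) ×
         (∀ (u′ : Hom W R) → π₁ ∘ u′ ≡ q₁ → π₂ ∘ u′ ≡ q₂ → u′ ≡ u))

  IsBisimulation : (G : Endo) → ∀ {X Y R} →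
                   Hom X (Endo.F₀ G X) → Hom Y (Endo.F₀ G Y) →
                   Hom R X → Hom R Y → Set (o ⊔ ℓ)
  IsBisimulation G {X} {Y} α β π₁ π₂ =
    JointlyMonic π₁ π₂ ×
    Σ Obj λ Z → Σ (Hom Z (Endo.F₀ G Z)) λ γ → Σ (Hom X Z) λ f → Σ (Hom Y Z) λ g →
      (Endo.F₁ G f ∘ α ≡ γ ∘ f) × (Endo.F₁ G g ∘ β ≡ γ ∘ g) × IsPullback f g π₁ π₂

record MonadOnCat (o ℓ : Level) : Set (lsuc (o ⊔ ℓ)) where
  field
    C          : RawCategory o ℓ
    isCategory : IsCategory C
    coproducts : BinaryCoproducts C
    T          : Endo C
    η          : Transformation C (IdE C) T
    μ          : Transformation C (compE C T T) T
    isMonad    : IsMonad C T η μ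

module Kleisli {o ℓ} (M : MonadOnCat o ℓ) where
  open MonadOnCat M public
  open RawCategory C public
  open BinaryCoproducts coproducts public
  open Endo T public renaming (F₀ to T₀; F₁ to T₁)

  infixr 9 _·_
  infix 4 _⊸_

  _⊸_ : Obj → Obj → Set ℓ
  X ⊸ Y = Hom X (T₀ Y)

  _·_ : ∀ {X Y Z} → Y ⊸ Z → X ⊸ Y → X ⊸ Z
  g · f = μ _ ∘ (T₁ g ∘ f)

  1ₖ : ∀ {X} → X ⊸ X
  1ₖ {X} = η X

  Kl : RawCategory o ℓ
  Kl = record { Obj = Obj ; Hom = _⊸_ ; id = 1ₖ ; _∘_ = _·_ }

  _♯ : ∀ {X Y} → Hom X Y → X ⊸ Y
  f ♯ = η _ ∘ f

  -- coprojections of Kl(T); cotupling [_,_] of Kl(T) is that of C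
  ι¹ : ∀ {A B} → A ⊸ A + B
  ι¹ = i₁ ♯

  ι² : ∀ {A B} → B ⊸ A + B
  ι² = i₂ ♯

  _⊕_ : ∀ {A A′ B B′} → A ⊸ A′ → B ⊸ B′ → A + B ⊸ A′ + B′
  a ⊕ b = [ ι¹ · a , ι² · b ]

  _⊞_ : ∀ {A A′ B B′} → Hom A A′ → Hom B B′ → Hom (A + B) (A′ + B′)
  a ⊞ b = [ i₁ ∘ a , i₂ ∘ b ]

  liftE : (S : Endo C) → (∀ {A B} → A ⊸ B → Endo.F₀ S A ⊸ Endo.F₀ S B) → Endo Kl
  liftE S S̄₁ = record { F₀ = Endo.F₀ S ; F₁ = S̄₁ }

  IsLifting : (S : Endo C) → (∀ {A B} → A ⊸ B → Endo.F₀ S A ⊸ Endo.F₀ S B) → Set (o ⊔ ℓ)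
  IsLifting S S̄₁ = IsEndofunctor Kl (liftE S S̄₁) ×
                   (∀ {A B} (f : Hom A B) → S̄₁ (f ♯) ≡ (Endo.F₁ S f) ♯)

  FτC : Endo C → Endo C
  FτC F = record { F₀ = λ X → Endo.F₀ F X + X ; F₁ = λ f → Endo.F₁ F f ⊞ f }

  F̄τ : (F : Endo C) → (∀ {A B} → A ⊸ B → Endo.F₀ F A ⊸ Endo.F₀ F B) → Endo Kl
  F̄τ F F̄₁ = record { F₀ = λ X → Endo.F₀ F X + X ; F₁ = λ a → F̄₁ a ⊕ a }

  e′ : (F : Endo C) → ∀ X → X ⊸ Endo.F₀ F X + X
  e′ F X = ι²

  m′ : (zero : ∀ {X Y} → X ⊸ Y) (F : Endo C) →
       (F̄₁ : ∀ {A B} → A ⊸ B → Endo.F₀ F A ⊸ Endo.F₀ F B) →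
       ∀ X → Endo.F₀ F (Endo.F₀ F X + X) + (Endo.F₀ F X + X) ⊸ Endo.F₀ F X + X
  m′ zero F F̄₁ X = [ ι¹ , 1ₖ ] · (F̄₁ [ zero , 1ₖ ] ⊕ 1ₖ)

  record Setting (r : Level) : Set (o ⊔ ℓ ⊔ lsuc r) where
    infix 4 _≤_
    infix 10 _*
    field
      _≤_       : ∀ {X Y} → X ⊸ Y → X ⊸ Y → Set r
      ≤-isPartialOrder : ∀ {X Y} → IsPartialOrder (_≡_ {A = X ⊸ Y}) _≤_
      ·-mono    : ∀ {X Y Z} {f f′ : X ⊸ Y} {g g′ : Y ⊸ Z} →
                  f ≤ f′ → g ≤ g′ → g · f ≤ g′ · f′
      _*        : ∀ {X} → X ⊸ X → X ⊸ X
      sat-a     : ∀ {X} (α : X ⊸ X) → 1ₖ ≤ α *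
      sat-b     : ∀ {X} (α : X ⊸ X) → α ≤ α *
      sat-c     : ∀ {X} (α : X ⊸ X) → α * · α * ≤ α *
      sat-d     : ∀ {X} (α β : X ⊸ X) → 1ₖ ≤ β → α ≤ β → β · β ≤ β → α * ≤ β
      sat-e≤    : ∀ {X Y} (f : Hom X Y) (α : X ⊸ X) (β : Y ⊸ Y) →
                  f ♯ · α ≤ β · f ♯ → f ♯ · α * ≤ β * · f ♯
      sat-e≥    : ∀ {X Y} (f : Hom X Y) (α : X ⊸ X) (β : Y ⊸ Y) →
                  β · f ♯ ≤ f ♯ · α → β * · f ♯ ≤ f ♯ · α *
      0ₖ        : ∀ {X Y} → X ⊸ Y
      0-left    : ∀ {X Y Z} (f : Y ⊸ Z) → f · 0ₖ {X} {Y} ≡ 0ₖ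
      0-right   : ∀ {X Y Z} (g : X ⊸ Y) → 0ₖ {Y} {Z} · g ≡ 0ₖ
      F         : Endo C
      F-isEndofunctor : IsEndofunctor C F
      F̄₁        : ∀ {A B} → A ⊸ B → Endo.F₀ F A ⊸ Endo.F₀ F B
      F̄-isLifting : IsLifting F F̄₁
      F̄τ-isMonad : IsMonad Kl (F̄τ F F̄₁) (e′ F) (m′ 0ₖ F F̄₁)
      F*        : Endo C
      ηF*       : Transformation C (IdE C) F*
      μF*       : Transformation C (compE C F* F*) F*
      νF*       : Transformation C F F*
      F*-free   : IsFreeMonadOver C F F* ηF* μF* νF*
      F̄*₁       : ∀ {A B} → A ⊸ B → Endo.F₀ F* A ⊸ Endo.F₀ F* B
      F̄*-isLifting : IsLifting F* F̄*₁
      m         : Transformation Kl (compE Kl (liftE F* F̄*₁) (liftE F* F̄*₁)) (liftE F* F̄*₁)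
      e         : Transformation Kl (IdE Kl) (liftE F* F̄*₁)
      ν         : Transformation Kl (liftE F F̄₁) (liftE F* F̄*₁)
      F̄*-free   : IsFreeMonadOver Kl (liftE F F̄₁) (liftE F* F̄*₁) e m ν
      F̄τ-mono   : ∀ {A B} {a b : A ⊸ B} → a ≤ b → Endo.F₁ (F̄τ F F̄₁) a ≤ Endo.F₁ (F̄τ F F̄₁) b
      F̄*-mono   : ∀ {A B} {a b : A ⊸ B} → a ≤ b → F̄*₁ a ≤ F̄*₁ b
      F̄τ-sat    : ∀ {X} (α : X ⊸ Endo.F₀ F X + X) →
                  m′ 0ₖ F F̄₁ X · Endo.F₁ (F̄τ F F̄₁)
                    ((m′ 0ₖ F F̄₁ X · Endo.F₁ (F̄τ F F̄₁) α) * · e′ F X)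
                  ≡ (m′ 0ₖ F F̄₁ X · Endo.F₁ (F̄τ F F̄₁) α) *
      F̄*-sat    : ∀ {X} (α : X ⊸ Endo.F₀ F* X) →
                  m X · F̄*₁ ((m X · F̄*₁ α) * · e X) ≡ (m X · F̄*₁ α) *

  module Derived {r} (S : Setting r) where
    open Setting S public
    open Endo F public using (F₀; F₁)
    open Endo F* public using () renaming (F₀ to F*₀; F₁ to F*₁)

    F̄E : Endo Kl
    F̄E = liftE F F̄₁

    F̄*E : Endo Kl
    F̄*E = liftE F* F̄*₁

    F̄τE : Endo Kl
    F̄τE = F̄τ F F̄₁

    F̄τ₁ : ∀ {A B} → A ⊸ B → F₀ A + A ⊸ F₀ B + B
    F̄τ₁ = Endo.F₁ F̄τE

    e′X : ∀ X → X ⊸ F₀ X + X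
    e′X = e′ F

    m′X : ∀ X → F₀ (F₀ X + X) + (F₀ X + X) ⊸ F₀ X + X
    m′X = m′ 0ₖ F F̄₁

    under : ∀ {X} → X ⊸ F₀ X + X → X ⊸ F*₀ X
    under {X} α = [ ν X , e X ] · α

    _★ : ∀ {X} → X ⊸ F₀ X + X → X ⊸ F₀ X + X
    _★ {X} α = (m′X X · F̄τ₁ α) * · e′X X

    _⊛ : ∀ {X} → X ⊸ F*₀ X → X ⊸ F*₀ X
    _⊛ {X} β = (m X · F̄*₁ β) * · e X

    TFτ : Endo C
    TFτ = compE C T (FτC F)

    TF* : Endo C
    TF* = compE C T F*

-- The monad morphism h carries the TF*-saturation of α̲ to the TF_τ-saturation of α:
-- h · α̲ = α makes h intertwine m · F̄*α̲ with m′ · F̄τα, so the hypothesis on h gives α★ = h · α̲⊛. A natural transformation between liftings turns every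
-- TF*-coalgebra homomorphism f : α̲⊛ → γ into a TF_τ-coalgebra homomorphism
-- f : h · α̲⊛ → h · γ, so the cospan witnessing a bisimulation for α̲⊛ witnesses one for α★.
module Submission where

open import Defs
open import Relation.Binary.PropositionalEquality using (_≡_; sym; trans; cong; cong₂; subst; module ≡-Reasoning)
open import Data.Product using (_,_; proj₂)

module MonadMorphismProperties {o ℓ} {C : RawCategory o ℓ} (isCategory : IsCategory C) where
  open RawCategory C
  open IsCategory isCategory
  open ≡-Reasoning

  μ∘F₁-intertwine : ∀ {S ηS μS R ηR μR k} → IsMonad C R ηR μR →
    IsMonadMorphism C S ηS μS R ηR μR k →
    ∀ {X} {β : Hom X (Endo.F₀ S X)} {α : Hom X (Endo.F₀ R X)} → k X ∘ β ≡ α →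
    k X ∘ (μS X ∘ Endo.F₁ S β) ≡ (μR X ∘ Endo.F₁ R α) ∘ k X
  μ∘F₁-intertwine {S} {μS = μS} {R} {μR = μR} {k} isMonadR hom {X} {β} {α} kβ≡α = begin
    k X ∘ (μS X ∘ S₁ β)                  ≡⟨ sym assoc ⟩
    (k X ∘ μS X) ∘ S₁ β                  ≡⟨ cong (_∘ S₁ β) mult ⟩
    (μR X ∘ (R₁ (k X) ∘ k (S₀ X))) ∘ S₁ β ≡⟨ trans assoc (cong (μR X ∘_) assoc) ⟩
    μR X ∘ (R₁ (k X) ∘ (k (S₀ X) ∘ S₁ β)) ≡⟨ cong (λ t → μR X ∘ (R₁ (k X) ∘ t)) (natural β) ⟩
    μR X ∘ (R₁ (k X) ∘ (R₁ β ∘ k X))      ≡⟨ cong (μR X ∘_) (sym assoc) ⟩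
    μR X ∘ ((R₁ (k X) ∘ R₁ β) ∘ k X)      ≡⟨ cong (λ t → μR X ∘ (t ∘ k X)) (sym F-∘) ⟩
    μR X ∘ (R₁ (k X ∘ β) ∘ k X)           ≡⟨ cong (λ t → μR X ∘ (R₁ t ∘ k X)) kβ≡α ⟩
    μR X ∘ (R₁ α ∘ k X)                   ≡⟨ sym assoc ⟩
    (μR X ∘ R₁ α) ∘ k X                   ∎
    where
      open Endo S using () renaming (F₀ to S₀; F₁ to S₁)
      open Endo R using () renaming (F₁ to R₁)
      open IsMonadMorphism hom
      open IsEndofunctor (IsMonad.isEndofunctor isMonadR)

module KleisliProperties {o ℓ} (M : MonadOnCat o ℓ) where
  open Kleisli M
  open ≡-Reasoning
  private
    module C = IsCategory isCategory
    module T = IsMonad isMonad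
    module T₁ = IsEndofunctor T.isEndofunctor

  ·-identityˡ : ∀ {X Y} (f : X ⊸ Y) → 1ₖ · f ≡ f
  ·-identityˡ f = trans (sym C.assoc) (trans (cong (_∘ f) T.identityˡ) C.identityˡ)

  ·-identityʳ : ∀ {X Y} (f : X ⊸ Y) → f · 1ₖ ≡ f
  ·-identityʳ {X} {Y} f = begin
    μ Y ∘ (T₁ f ∘ η X)     ≡⟨ cong (μ Y ∘_) (sym (T.η-natural f)) ⟩
    μ Y ∘ (η (T₀ Y) ∘ f)   ≡⟨ sym C.assoc ⟩
    (μ Y ∘ η (T₀ Y)) ∘ f   ≡⟨ trans (cong (_∘ f) T.identityʳ) C.identityˡ ⟩
    f                      ∎

  ·-assoc : ∀ {X Y Z W} (h : Z ⊸ W) (g : Y ⊸ Z) (f : X ⊸ Y) → (h · g) · f ≡ h · (g · f)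
  ·-assoc {Z = Z} {W} h g f = begin
    μ W ∘ (T₁ (μ W ∘ (T₁ h ∘ g)) ∘ f)
      ≡⟨ cong (λ t → μ W ∘ (t ∘ f)) (trans T₁.F-∘ (cong (T₁ (μ W) ∘_) T₁.F-∘)) ⟩
    μ W ∘ ((T₁ (μ W) ∘ (T₁ (T₁ h) ∘ T₁ g)) ∘ f)
      ≡⟨ trans (cong (μ W ∘_) C.assoc) (sym C.assoc) ⟩
    (μ W ∘ T₁ (μ W)) ∘ ((T₁ (T₁ h) ∘ T₁ g) ∘ f)
      ≡⟨ cong (_∘ ((T₁ (T₁ h) ∘ T₁ g) ∘ f)) T.assoc ⟩
    (μ W ∘ μ (T₀ W)) ∘ ((T₁ (T₁ h) ∘ T₁ g) ∘ f)
      ≡⟨ trans C.assoc (cong (μ W ∘_) (trans (cong (μ (T₀ W) ∘_) C.assoc) (sym C.assoc))) ⟩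
    μ W ∘ ((μ (T₀ W) ∘ T₁ (T₁ h)) ∘ (T₁ g ∘ f))
      ≡⟨ cong (λ t → μ W ∘ (t ∘ (T₁ g ∘ f))) (T.μ-natural h) ⟩
    μ W ∘ ((T₁ h ∘ μ Z) ∘ (T₁ g ∘ f))
      ≡⟨ cong (μ W ∘_) C.assoc ⟩
    μ W ∘ (T₁ h ∘ (μ Z ∘ (T₁ g ∘ f))) ∎

  Kl-isCategory : IsCategory Kl
  Kl-isCategory = record
    { identityˡ = ·-identityˡ _
    ; identityʳ = ·-identityʳ _
    ; assoc     = ·-assoc _ _ _
    }

  ♯-· : ∀ {X Y Z} (k : Hom Y Z) (a : X ⊸ Y) → k ♯ · a ≡ T₁ k ∘ a
  ♯-· {Z = Z} k a = begin
    μ Z ∘ (T₁ (η Z ∘ k) ∘ a)       ≡⟨ cong (λ t → μ Z ∘ (t ∘ a)) T₁.F-∘ ⟩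
    μ Z ∘ ((T₁ (η Z) ∘ T₁ k) ∘ a)  ≡⟨ trans (cong (μ Z ∘_) C.assoc) (sym C.assoc) ⟩
    (μ Z ∘ T₁ (η Z)) ∘ (T₁ k ∘ a)  ≡⟨ trans (cong (_∘ (T₁ k ∘ a)) T.identityˡ) C.identityˡ ⟩
    T₁ k ∘ a                       ∎

  ·-♯ : ∀ {X Y Z} (a : Y ⊸ Z) (k : Hom X Y) → a · k ♯ ≡ a ∘ k
  ·-♯ a k = trans (cong (μ _ ∘_) (sym C.assoc)) (trans (sym C.assoc) (cong (_∘ k) (·-identityʳ a)))

  ♯-∘ : ∀ {X Y Z} (g : Hom Y Z) (f : Hom X Y) → g ♯ · f ♯ ≡ (g ∘ f) ♯
  ♯-∘ g f = trans (·-♯ (g ♯) f) C.assoc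

  ∘-[,] : ∀ {A B D E} (k : Hom D E) (a : Hom A D) (b : Hom B D) → k ∘ [ a , b ] ≡ [ k ∘ a , k ∘ b ]
  ∘-[,] k a b = unique (trans C.assoc (cong (k ∘_) inject₁)) (trans C.assoc (cong (k ∘_) inject₂))

  ·-[,] : ∀ {A B D E} (c : D ⊸ E) (a : A ⊸ D) (b : B ⊸ D) → c · [ a , b ] ≡ [ c · a , c · b ]
  ·-[,] c a b = trans (cong (μ _ ∘_) (∘-[,] (T₁ c) a b)) (∘-[,] (μ _) _ _)

  [ι¹,ι²]≡1ₖ : ∀ {A B} → [ ι¹ {A} {B} , ι² ] ≡ 1ₖ
  [ι¹,ι²]≡1ₖ = begin
    [ η _ ∘ i₁ , η _ ∘ i₂ ] ≡⟨ sym (∘-[,] (η _) i₁ i₂) ⟩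
    η _ ∘ [ i₁ , i₂ ]       ≡⟨ cong (η _ ∘_) (sym (unique C.identityˡ C.identityˡ)) ⟩
    η _ ∘ id                ≡⟨ C.identityʳ ⟩
    η _                     ∎

  module NaturalTransformationBetweenLiftings
    (S R : Endo C)
    (S̄₁ : ∀ {A B} → A ⊸ B → Endo.F₀ S A ⊸ Endo.F₀ S B)
    (R̄₁ : ∀ {A B} → A ⊸ B → Endo.F₀ R A ⊸ Endo.F₀ R B)
    (S̄₁-♯ : ∀ {A B} (f : Hom A B) → S̄₁ (f ♯) ≡ Endo.F₁ S f ♯)
    (R̄₁-♯ : ∀ {A B} (f : Hom A B) → R̄₁ (f ♯) ≡ Endo.F₁ R f ♯)
    (k : Transformation Kl (liftE S S̄₁) (liftE R R̄₁))
    (k-natural : IsNatural Kl (liftE S S̄₁) (liftE R R̄₁) k)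
    where
    open Endo S using () renaming (F₀ to S₀; F₁ to S₁)
    open Endo R using () renaming (F₁ to R₁)

    coalgebraHomomorphism-map : ∀ {X Z} {α : X ⊸ S₀ X} {γ : Z ⊸ S₀ Z} (f : Hom X Z) →
      T₁ (S₁ f) ∘ α ≡ γ ∘ f → T₁ (R₁ f) ∘ (k X · α) ≡ (k Z · γ) ∘ f
    coalgebraHomomorphism-map {X} {Z} {α} {γ} f f-hom = begin
      T₁ (R₁ f) ∘ (k X · α)     ≡⟨ sym (♯-· (R₁ f) _) ⟩
      R₁ f ♯ · (k X · α)        ≡⟨ cong (_· (k X · α)) (sym (R̄₁-♯ f)) ⟩
      R̄₁ (f ♯) · (k X · α)      ≡⟨ sym (·-assoc _ _ _) ⟩
      (R̄₁ (f ♯) · k X) · α      ≡⟨ cong (_· α) (sym (k-natural (f ♯))) ⟩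
      (k Z · S̄₁ (f ♯)) · α      ≡⟨ ·-assoc _ _ _ ⟩
      k Z · (S̄₁ (f ♯) · α)      ≡⟨ cong (λ t → k Z · (t · α)) (S̄₁-♯ f) ⟩
      k Z · (S₁ f ♯ · α)        ≡⟨ cong (k Z ·_) (trans (♯-· (S₁ f) α) f-hom) ⟩
      k Z · (γ ∘ f)             ≡⟨ cong (k Z ·_) (sym (·-♯ γ f)) ⟩
      k Z · (γ · f ♯)           ≡⟨ trans (sym (·-assoc _ _ _)) (·-♯ _ f) ⟩
      (k Z · γ) ∘ f             ∎

    isBisimulation-map : ∀ {X Y P} {α : X ⊸ S₀ X} {β : Y ⊸ S₀ Y} (π₁ : Hom P X) (π₂ : Hom P Y) →
      IsBisimulation C (compE C T S) α β π₁ π₂ →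
      IsBisimulation C (compE C T R) (k X · α) (k Y · β) π₁ π₂
    isBisimulation-map π₁ π₂ (monic , Z , γ , f , g , f-hom , g-hom , pullback) =
      monic , Z , k Z · γ , f , g ,
      coalgebraHomomorphism-map f f-hom , coalgebraHomomorphism-map g g-hom , pullback

module SaturationComparison {o ℓ r} (M : MonadOnCat o ℓ) (S : Kleisli.Setting M r) where
  open Kleisli M
  open Derived S
  open KleisliProperties M
  open ≡-Reasoning

  F̄τ₁-♯ : ∀ {X Y} (f : Hom X Y) → F̄τ₁ (f ♯) ≡ (F₁ f ⊞ f) ♯
  F̄τ₁-♯ f = begin
    [ ι¹ · F̄₁ (f ♯) , ι² · f ♯ ] ≡⟨ cong (λ t → [ ι¹ · t , ι² · f ♯ ]) (proj₂ F̄-isLifting f) ⟩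
    [ ι¹ · F₁ f ♯ , ι² · f ♯ ]   ≡⟨ cong₂ [_,_] (♯-∘ i₁ (F₁ f)) (♯-∘ i₂ f) ⟩
    [ (i₁ ∘ F₁ f) ♯ , (i₂ ∘ f) ♯ ] ≡⟨ sym (∘-[,] (η _) _ _) ⟩
    (F₁ f ⊞ f) ♯                 ∎

  module AlongMonadMorphism (h : Transformation Kl F̄*E F̄τE)
           (h-isMonadMorphism : IsMonadMorphism Kl F̄*E e m F̄τE e′X m′X h)
           (h∘ν≡ι¹ : ∀ X → h X · ν X ≡ ι¹)
           (h-preserves-* : ∀ X (φ : F*₀ X ⊸ F*₀ X) (ψ : F₀ X + X ⊸ F₀ X + X) →
                            ψ · h X ≡ h X · φ → ψ * · h X ≡ h X · φ *)
           where
    open IsMonadMorphism h-isMonadMorphism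
    open MonadMorphismProperties Kl-isCategory

    h·under : ∀ {X} (α : X ⊸ F₀ X + X) → h X · under α ≡ α
    h·under {X} α = begin
      h X · ([ ν X , e X ] · α)     ≡⟨ sym (·-assoc _ _ _) ⟩
      (h X · [ ν X , e X ]) · α     ≡⟨ cong (_· α) (·-[,] (h X) (ν X) (e X)) ⟩
      [ h X · ν X , h X · e X ] · α ≡⟨ cong (_· α) (cong₂ [_,_] (h∘ν≡ι¹ X) unit) ⟩
      [ ι¹ , ι² ] · α               ≡⟨ cong (_· α) [ι¹,ι²]≡1ₖ ⟩
      1ₖ · α                        ≡⟨ ·-identityˡ α ⟩
      α                             ∎

    ★≡h·under⊛ : ∀ {X} (α : X ⊸ F₀ X + X) → α ★ ≡ h X · under α ⊛
    ★≡h·under⊛ {X} α = begin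
      ψ * · e′X X       ≡⟨ cong (ψ * ·_) (sym unit) ⟩
      ψ * · (h X · e X) ≡⟨ sym (·-assoc _ _ _) ⟩
      (ψ * · h X) · e X ≡⟨ cong (_· e X) (h-preserves-* X φ ψ (sym h·φ≡ψ·h)) ⟩
      (h X · φ *) · e X ≡⟨ ·-assoc _ _ _ ⟩
      h X · (φ * · e X) ∎
      where
        φ : F*₀ X ⊸ F*₀ X
        φ = m X · F̄*₁ (under α)
        ψ : F₀ X + X ⊸ F₀ X + X
        ψ = m′X X · F̄τ₁ α
        h·φ≡ψ·h : h X · φ ≡ ψ · h X
        h·φ≡ψ·h = μ∘F₁-intertwine F̄τ-isMonad h-isMonadMorphism (h·under α)

    open NaturalTransformationBetweenLiftings F* (FτC F) F̄*₁ F̄τ₁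
      (proj₂ F̄*-isLifting) F̄τ₁-♯ h natural public

theorem6 : ∀ {o ℓ r} (M : MonadOnCat o ℓ) (S : Kleisli.Setting M r) →
    let open Kleisli M in let open Derived S in
    (h : Transformation Kl F̄*E F̄τE) →
    IsMonadMorphism Kl F̄*E e m F̄τE e′X m′X h →
    (∀ X → h X · ν X ≡ ι¹) →
    (∀ X (φ : F*₀ X ⊸ F*₀ X) (ψ : F₀ X + X ⊸ F₀ X + X) →
       ψ · h X ≡ h X · φ → ψ * · h X ≡ h X · φ *) →
    ∀ {X} (α : X ⊸ F₀ X + X) {R} (π₁ π₂ : Hom R X) →
    IsBisimulation C TF* (under α ⊛) (under α ⊛) π₁ π₂ →
    IsBisimulation C TFτ (α ★) (α ★) π₁ π₂
theorem6 M S h h-isMonadMorphism h∘ν≡ι¹ h-preserves-* α π₁ π₂ bisim =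
  subst (λ β → IsBisimulation C TFτ β β π₁ π₂) (sym (★≡h·under⊛ α))
    (isBisimulation-map π₁ π₂ bisim)
  where
    open Kleisli M
    open Derived S
    open SaturationComparison.AlongMonadMorphism M S h h-isMonadMorphism h∘ν≡ι¹ h-preserves-*
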